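{- For every integer $n\ge 0$, $$T_{n+2}=\sum_{k=0}^{n+1}F_kT_{n-k},$$ where $F_k$ are the Fibonacci numbers and $T_j$ the tribonacci numbers extended to $j=-1$ by $T_{ -1}=1$.
   Context: Fibonacci numbers: $F_0=0$, $F_1=1$, $F_k=F_{k-1}+F_{k-2}$. Tribonacci numbers: $T_0=T_1=0$, $T_2=1$, $T_n=T_{n-1}+T_{n-2}+T_{n-3}$ for $n\ge3$; the value $T_{ -1}=1$ is obtained by extending the recurrence backwards via $T_{n-3}=T_n-T_{n-1}-T_{n-2}$. -}

module Defs where

open import Data.Nat using (ℕ; zero; suc; _+_; _∸_)

F : ℕ → ℕ
F zero = 0
F (suc zero) = 1
F (suc (suc k)) = F (suc k) + F k

T : ℕ → ℕ
T zero = 0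
T (suc zero) = 0
T (suc (suc zero)) = 1
T (suc (suc (suc n))) = T (suc (suc n)) + T (suc n) + T n

-- Tribonacci extended to index -1: Tshift j = T_{j-1}, so Tshift 0 = T_{-1} = 1
-- (the value obtained by running the recurrence backwards: T_2 - T_1 - T_0 = 1).
Tshift : ℕ → ℕ
Tshift zero = 1
Tshift (suc j) = T j

sumTo : ℕ → (ℕ → ℕ) → ℕ
sumTo zero f = f 0
sumTo (suc m) f = sumTo m f + f (suc m)

-- Write C g m = Σ_{k ≤ m} F_k g(m − k) for the Fibonacci convolution of g.  Because
-- F_0 = 0, F_1 = 1 and F obeys the Fibonacci recurrence, C g (m+2) = g(m+1) + C g (m+1) + C g m.
-- For g = T shifted by one (so that g 0 = T_{-1}), this is the tribonacci recurrence for
-- C g shifted by two, and the initial values agree; hence C g m = T_{m+1}.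
module Submission where

open import Defs
open import Data.Nat using (ℕ; zero; suc; _+_; _*_; _∸_)
open import Data.Nat.Properties
  using (+-comm; +-assoc; +-identityʳ; *-distribʳ-+; +-commutativeSemigroup)
open import Algebra.Properties.CommutativeSemigroup +-commutativeSemigroup using (interchange)
open import Relation.Binary.PropositionalEquality
  using (_≡_; refl; sym; trans; cong; cong₂; module ≡-Reasoning)

sumTo-cong : ∀ m {f g : ℕ → ℕ} → (∀ k → f k ≡ g k) → sumTo m f ≡ sumTo m g
sumTo-cong zero    f≗g = f≗g 0
sumTo-cong (suc m) f≗g = cong₂ _+_ (sumTo-cong m f≗g) (f≗g (suc m))

sumTo-+ : ∀ m (f g : ℕ → ℕ) → sumTo m (λ k → f k + g k) ≡ sumTo m f + sumTo m g
sumTo-+ zero    f g = refl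
sumTo-+ (suc m) f g = trans (cong (_+ (f (suc m) + g (suc m))) (sumTo-+ m f g))
                            (interchange (sumTo m f) (sumTo m g) (f (suc m)) (g (suc m)))

sumTo-sucˡ : ∀ m (h : ℕ → ℕ) → sumTo (suc m) h ≡ h 0 + sumTo m (λ k → h (suc k))
sumTo-sucˡ zero    h = refl
sumTo-sucˡ (suc m) h = trans (cong (_+ h (suc (suc m))) (sumTo-sucˡ m h))
                             (+-assoc (h 0) _ _)

fibConv : (ℕ → ℕ) → ℕ → ℕ
fibConv g m = sumTo m (λ k → F k * g (m ∸ k))

-- The k = 0 term vanishes since F 0 = 0.
fibConv-suc : ∀ g m → fibConv g (suc m) ≡ sumTo m (λ k → F (suc k) * g (m ∸ k))
fibConv-suc g m = sumTo-sucˡ m (λ k → F k * g (suc m ∸ k))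

fibConv-recurrence : ∀ g m →
  fibConv g (suc (suc m)) ≡ g (suc m) + fibConv g (suc m) + fibConv g m
fibConv-recurrence g m = begin
    fibConv g (suc (suc m))
  ≡⟨ fibConv-suc g (suc m) ⟩
    sumTo (suc m) (λ k → F (suc k) * g (suc m ∸ k))
  ≡⟨ sumTo-sucˡ m (λ k → F (suc k) * g (suc m ∸ k)) ⟩
    (g (suc m) + 0) + sumTo m (λ k → F (suc (suc k)) * g (m ∸ k))
  ≡⟨ cong₂ _+_ (+-identityʳ (g (suc m)))
               (sumTo-cong m (λ k → *-distribʳ-+ (g (m ∸ k)) (F (suc k)) (F k))) ⟩
    g (suc m) + sumTo m (λ k → F (suc k) * g (m ∸ k) + F k * g (m ∸ k))
  ≡⟨ cong (g (suc m) +_) (sumTo-+ m _ _) ⟩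
    g (suc m) + (sumTo m (λ k → F (suc k) * g (m ∸ k)) + fibConv g m)
  ≡⟨ sym (+-assoc (g (suc m)) _ _) ⟩
    g (suc m) + sumTo m (λ k → F (suc k) * g (m ∸ k)) + fibConv g m
  ≡⟨ cong (λ x → g (suc m) + x + fibConv g m) (sym (fibConv-suc g m)) ⟩
    g (suc m) + fibConv g (suc m) + fibConv g m
  ∎
  where open ≡-Reasoning

Tshift-recurrence : ∀ m →
  Tshift (suc (suc (suc m))) ≡ Tshift (suc (suc m)) + Tshift (suc m) + Tshift m
Tshift-recurrence zero    = refl
Tshift-recurrence (suc m) = refl

fibConv-Tshift : ∀ m → fibConv Tshift m ≡ Tshift (suc (suc m))
fibConv-Tshift zero          = refl
fibConv-Tshift (suc zero)    = refl
fibConv-Tshift (suc (suc m)) = begin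
    fibConv Tshift (suc (suc m))
  ≡⟨ fibConv-recurrence Tshift m ⟩
    Tshift (suc m) + fibConv Tshift (suc m) + fibConv Tshift m
  ≡⟨ cong₂ (λ x y → Tshift (suc m) + x + y) (fibConv-Tshift (suc m)) (fibConv-Tshift m) ⟩
    Tshift (suc m) + Tshift (suc (suc (suc m))) + Tshift (suc (suc m))
  ≡⟨ +-assoc (Tshift (suc m)) _ _ ⟩
    Tshift (suc m) + (Tshift (suc (suc (suc m))) + Tshift (suc (suc m)))
  ≡⟨ +-comm (Tshift (suc m)) _ ⟩
    Tshift (suc (suc (suc m))) + Tshift (suc (suc m)) + Tshift (suc m)
  ≡⟨ sym (Tshift-recurrence (suc m)) ⟩
    Tshift (suc (suc (suc (suc m))))
  ∎
  where open ≡-Reasoning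

theorem15 : (n : ℕ) → T (n + 2) ≡ sumTo (suc n) (λ k → F k * Tshift (suc n ∸ k))
theorem15 n = trans (cong T (+-comm n 2)) (sym (fibConv-Tshift (suc n)))
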